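{- (d'Ocagne's identity) Let $k>0$ be real and $Q_{k,n}=F_{k,n}+i\,F_{k,n+1}+j\,F_{k,n+2}+ij\,F_{k,n+3}$. For all integers $n,m\ge0$, $$Q_{k,n}Q_{k,m+1}-Q_{k,n+1}Q_{k,m}=(-1)^m F_{k,n-m}\,\big[\,2(k^2+2)\,j+(k^3+2k)\,ij\,\big].$$
   Context: For a real number $k>0$, the $k$-Fibonacci numbers are $F_{k,0}=0$, $F_{k,1}=1$, $F_{k,n+1}=kF_{k,n}+F_{k,n-1}$, extended to negative indices by the same recurrence, i.e. $F_{k,-n}=(-1)^{n+1}F_{k,n}$. Bicomplex numbers form the real commutative associative algebra with basis $\{1,i,j,ij\}$, $i^2=j^2=-1$, $ij=ji$, $(ij)^2=1$; $Q_{k,n}$ is the bicomplex $k$-Fibonacci quaternion, multiplied in this algebra. -}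

module Defs where

open import Level using (_⊔_)
open import Algebra.Bundles using (CommutativeRing)
open import Data.Nat using (ℕ; zero; suc)
open import Data.Integer using (ℤ; +_; -[1+_])
open import Data.Product using (_×_)

-- k-Fibonacci numbers and bicomplex numbers over an arbitrary commutative
-- ring R (the paper uses R = ℝ, k > 0).
module KFib {c ℓ} (R : CommutativeRing c ℓ) (k : CommutativeRing.Carrier R) where
  open CommutativeRing R

  F : ℕ → Carrier
  F zero = 0#
  F (suc zero) = 1#
  F (suc (suc n)) = k * F (suc n) + F n

  sgn : ℕ → Carrier
  sgn zero = 1#
  sgn (suc m) = - sgn m

  Fℤ : ℤ → Carrier
  Fℤ (+ n) = F n
  Fℤ -[1+ n ] = sgn (suc (suc n)) * F (suc n)

  record Bicomplex : Set c where
    constructor bc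
    field
      re  : Carrier
      ci  : Carrier
      cj  : Carrier
      cij : Carrier
  open Bicomplex public

  infixl 7 _·_ _◃_
  infixl 6 _⊕_ _⊖_
  infix 4 _≈B_

  _≈B_ : Bicomplex → Bicomplex → Set ℓ
  x ≈B y = (re x ≈ re y) × (ci x ≈ ci y) × (cj x ≈ cj y) × (cij x ≈ cij y)

  _⊕_ : Bicomplex → Bicomplex → Bicomplex
  x ⊕ y = bc (re x + re y) (ci x + ci y) (cj x + cj y) (cij x + cij y)

  _⊖_ : Bicomplex → Bicomplex → Bicomplex
  x ⊖ y = bc (re x - re y) (ci x - ci y) (cj x - cj y) (cij x - cij y)

  -- multiplication with i² = j² = -1, ij = ji, (ij)² = 1
  _·_ : Bicomplex → Bicomplex → Bicomplex
  bc a b c' d · bc a' b' c'' d' =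
    bc (a * a' - b * b' - c' * c'' + d * d')
       (a * b' + b * a' - c' * d' - d * c'')
       (a * c'' + c' * a' - b * d' - d * b')
       (a * d' + d * a' + b * c'' + c' * b')

  _◃_ : Carrier → Bicomplex → Bicomplex
  r ◃ bc a b c' d = bc (r * a) (r * b) (r * c') (r * d)

  Q : ℕ → Bicomplex
  Q n = bc (F n) (F (suc n)) (F (suc (suc n))) (F (suc (suc (suc n))))

  two : Carrier
  two = 1# + 1#

  D : Bicomplex
  D = bc 0# 0# (two * (k * k + two)) (k * k * k + two * k)

-- For the k-Fibonacci numbers, shifting both
-- indices of F n F (m+1) − F (n+1) F m only flips its sign, which reduces d'Ocagne's
-- identity to the cases m = 0 and n = 0.  A quaternion Q n is determined by the pair
-- (F n , F (n+1)), and the quaternion difference is that same 2×2 determinant times a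
-- fixed bicomplex number, which turns out to be D.

module Submission where

open import Algebra.Bundles using (CommutativeRing; RawRing)
open import Algebra.Solver.Ring.AlmostCommutativeRing using (fromCommutativeRing; _-Raw-AlmostCommutative⟶_)
open import Data.Maybe using (Maybe; just; nothing)
open import Data.Nat as ℕ using (ℕ; zero; suc)
import Data.Nat.Properties as ℕ
import Data.Product as Prod
open import Data.Product using (_,_)
open import Relation.Binary.PropositionalEquality as ≡ using (_≡_)
open import Relation.Nullary using (yes; no)
open import Data.Integer using (+_) renaming (_⊖_ to _⊖ℤ_)
import Data.Integer.Properties as ℤ
open import Defs

-- Coefficients are formal differences a − b of natural numbers, read as a×1# − b×1#.
-- Comparing a + d with c + b soundly decides equality of the values of (a , b) and
-- (c , d), so no decidable equality on R itself is needed.  Sums and products are kept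
-- canonical because the solver compares normal forms up to ≡.
module CommutativeRingSolver {c ℓ} (R : CommutativeRing c ℓ) where
  open CommutativeRing R
  open import Algebra.Properties.Semiring.Mult semiring using (_×_; ×-homo-+; ×1-homo-*)
  open import Algebra.Properties.Ring ring using (x[y-z]≈xy-xz; [y-z]x≈yx-zx)
  open import Algebra.Properties.AbelianGroup +-abelianGroup using (ε⁻¹≈ε; ⁻¹-anti-homo‿-; ⁻¹-∙-comm)
  open import Algebra.Properties.CommutativeSemigroup +-commutativeSemigroup using (interchange)
  open import Relation.Binary.Reasoning.Setoid setoid

  Difference : Set
  Difference = ℕ Prod.× ℕ

  canonical : Difference → Difference
  canonical (a , b) = (a ℕ.∸ b , b ℕ.∸ a)

  Differences : RawRing _ _
  Differences = record
    { Carrier = Difference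
    ; _≈_     = _≡_
    ; _+_     = λ { (a , b) (c , d) → canonical (a ℕ.+ c , b ℕ.+ d) }
    ; _*_     = λ { (a , b) (c , d) → canonical (a ℕ.* c ℕ.+ b ℕ.* d , a ℕ.* d ℕ.+ b ℕ.* c) }
    ; -_      = λ { (a , b) → (b , a) }
    ; 0#      = (0 , 0)
    ; 1#      = (1 , 0)
    }

  ⟦_⟧ᵈ : Difference → Carrier
  ⟦ a , b ⟧ᵈ = a × 1# - b × 1#

  [x+z]-[y+w]≈[x-y]+[z-w] : ∀ x y z w → (x + z) - (y + w) ≈ (x - y) + (z - w)
  [x+z]-[y+w]≈[x-y]+[z-w] x y z w = begin
    (x + z) + - (y + w)   ≈⟨ +-congˡ (sym (⁻¹-∙-comm y w)) ⟩
    (x + z) + (- y + - w) ≈⟨ interchange x z (- y) (- w) ⟩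
    (x - y) + (z - w)     ∎

  ⟦⟧ᵈ-+-homo : ∀ a b c d → ⟦ a ℕ.+ c , b ℕ.+ d ⟧ᵈ ≈ ⟦ a , b ⟧ᵈ + ⟦ c , d ⟧ᵈ
  ⟦⟧ᵈ-+-homo a b c d = trans (+-cong (×-homo-+ 1# a c) (-‿cong (×-homo-+ 1# b d)))
                             ([x+z]-[y+w]≈[x-y]+[z-w] _ _ _ _)

  ⟦⟧ᵈ-*-homo : ∀ a b c d →
               ⟦ a ℕ.* c ℕ.+ b ℕ.* d , a ℕ.* d ℕ.+ b ℕ.* c ⟧ᵈ ≈ ⟦ a , b ⟧ᵈ * ⟦ c , d ⟧ᵈ
  ⟦⟧ᵈ-*-homo a b c d = begin
    ⟦ a ℕ.* c ℕ.+ b ℕ.* d , a ℕ.* d ℕ.+ b ℕ.* c ⟧ᵈ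
      ≈⟨ ⟦⟧ᵈ-+-homo (a ℕ.* c) (a ℕ.* d) (b ℕ.* d) (b ℕ.* c) ⟩
    ((a ℕ.* c) × 1# - (a ℕ.* d) × 1#) + ((b ℕ.* d) × 1# - (b ℕ.* c) × 1#)
      ≈⟨ +-cong (+-cong (×1-homo-* a c) (-‿cong (×1-homo-* a d)))
                (trans (sym (⁻¹-anti-homo‿- _ _))
                       (-‿cong (+-cong (×1-homo-* b c) (-‿cong (×1-homo-* b d))))) ⟩
    (A * C - A * D) - (B * C - B * D)  ≈⟨ sym (+-cong (x[y-z]≈xy-xz A C D) (-‿cong (x[y-z]≈xy-xz B C D))) ⟩
    A * (C - D) - B * (C - D)          ≈⟨ sym ([y-z]x≈yx-zx (C - D) A B) ⟩
    (A - B) * (C - D)                  ∎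
    where A = a × 1#; B = b × 1#; C = c × 1#; D = d × 1#

  ⟦⟧ᵈ-cancel : ∀ d a b → ⟦ d ℕ.+ a , d ℕ.+ b ⟧ᵈ ≈ ⟦ a , b ⟧ᵈ
  ⟦⟧ᵈ-cancel d a b = begin
    ⟦ d ℕ.+ a , d ℕ.+ b ⟧ᵈ          ≈⟨ ⟦⟧ᵈ-+-homo d d a b ⟩
    (d × 1# - d × 1#) + ⟦ a , b ⟧ᵈ  ≈⟨ +-congʳ (-‿inverseʳ (d × 1#)) ⟩
    0# + ⟦ a , b ⟧ᵈ                 ≈⟨ +-identityˡ _ ⟩
    ⟦ a , b ⟧ᵈ                      ∎

  ⟦⟧ᵈ-canonical : ∀ p → ⟦ canonical p ⟧ᵈ ≈ ⟦ p ⟧ᵈ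
  ⟦⟧ᵈ-canonical (zero  , zero)  = refl
  ⟦⟧ᵈ-canonical (zero  , suc b) = refl
  ⟦⟧ᵈ-canonical (suc a , zero)  = refl
  ⟦⟧ᵈ-canonical (suc a , suc b) = trans (⟦⟧ᵈ-canonical (a , b)) (sym (⟦⟧ᵈ-cancel 1 a b))

  ⟦0,0⟧ᵈ≈0# : ⟦ 0 , 0 ⟧ᵈ ≈ 0#
  ⟦0,0⟧ᵈ≈0# = -‿inverseʳ 0#

  ⟦1,0⟧ᵈ≈1# : ⟦ 1 , 0 ⟧ᵈ ≈ 1#
  ⟦1,0⟧ᵈ≈1# = trans (+-cong (+-identityʳ 1#) ε⁻¹≈ε) (+-identityʳ 1#)

  ⟦⟧ᵈ-homomorphism : Differences -Raw-AlmostCommutative⟶ fromCommutativeRing R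
  ⟦⟧ᵈ-homomorphism = record
    { ⟦_⟧    = ⟦_⟧ᵈ
    ; +-homo = λ { (a , b) (c , d) → trans (⟦⟧ᵈ-canonical (a ℕ.+ c , b ℕ.+ d)) (⟦⟧ᵈ-+-homo a b c d) }
    ; *-homo = λ { (a , b) (c , d) →
        trans (⟦⟧ᵈ-canonical (a ℕ.* c ℕ.+ b ℕ.* d , a ℕ.* d ℕ.+ b ℕ.* c)) (⟦⟧ᵈ-*-homo a b c d) }
    ; -‿homo = λ { (a , b) → sym (⁻¹-anti-homo‿- (a × 1#) (b × 1#)) }
    ; 0-homo = ⟦0,0⟧ᵈ≈0#
    ; 1-homo = ⟦1,0⟧ᵈ≈1#
    }

  _≟ᵈ_ : ∀ p q → Maybe (⟦ p ⟧ᵈ ≈ ⟦ q ⟧ᵈ)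
  (a , b) ≟ᵈ (c , d) with d ℕ.+ a ℕ.≟ b ℕ.+ c
  ... | no _  = nothing
  ... | yes e = just (begin
    ⟦ a , b ⟧ᵈ              ≈⟨ ⟦⟧ᵈ-cancel d a b ⟨
    ⟦ d ℕ.+ a , d ℕ.+ b ⟧ᵈ  ≡⟨ ≡.cong₂ (λ m n → ⟦ m , n ⟧ᵈ) e (ℕ.+-comm d b) ⟩
    ⟦ b ℕ.+ c , b ℕ.+ d ⟧ᵈ  ≈⟨ ⟦⟧ᵈ-cancel b c d ⟩
    ⟦ c , d ⟧ᵈ              ∎)

  open import Algebra.Solver.Ring Differences (fromCommutativeRing R) ⟦⟧ᵈ-homomorphism _≟ᵈ_ public

module _ {c ℓ} (R : CommutativeRing c ℓ) (k : CommutativeRing.Carrier R) where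
  open CommutativeRing R
  open KFib R k
  open CommutativeRingSolver R
  open import Algebra.Properties.Ring ring using (-‿distribˡ-*)
  open import Algebra.Properties.AbelianGroup +-abelianGroup using (ε⁻¹≈ε)
  open import Relation.Binary.Reasoning.Setoid setoid

  sgn*sgn≈1 : ∀ m → sgn m * sgn m ≈ 1#
  sgn*sgn≈1 zero    = *-identityʳ 1#
  sgn*sgn≈1 (suc m) = trans (solve 1 (λ s → (:- s) :* (:- s) := s :* s) refl (sgn m)) (sgn*sgn≈1 m)

  F-dOcagne : ∀ n m → F n * F (suc m) - F (suc n) * F m ≈ sgn m * Fℤ (n ⊖ℤ m)
  F-dOcagne n zero = begin
    F n * 1# - F (suc n) * 0#  ≈⟨ +-cong (*-identityʳ (F n)) (trans (-‿cong (zeroʳ _)) ε⁻¹≈ε) ⟩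
    F n + 0#                   ≈⟨ +-identityʳ (F n) ⟩
    F n                        ≈⟨ *-identityˡ (F n) ⟨
    1# * F n                   ∎
  F-dOcagne zero (suc m) = begin
    0# * F (suc (suc m)) - 1# * F (suc m)   ≈⟨ trans (+-cong (zeroˡ _) (-‿cong (*-identityˡ _))) (+-identityˡ _) ⟩
    - F (suc m)                             ≈⟨ -‿cong (trans (*-congʳ (sgn*sgn≈1 m)) (*-identityˡ _)) ⟨
    - (sgn m * sgn m * F (suc m))
      ≈⟨ solve 2 (λ s f → :- (s :* s :* f) := (:- s) :* ((:- (:- s)) :* f)) refl (sgn m) (F (suc m)) ⟩
    sgn (suc m) * Fℤ (0 ⊖ℤ suc m)           ∎
  F-dOcagne (suc n) (suc m) = begin
    F (suc n) * F (suc (suc m)) - F (suc (suc n)) * F (suc m)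
      ≈⟨ solve 5 (λ k x y u v → y :* (k :* v :+ u) :- (k :* y :+ x) :* v := :- (x :* v :- y :* u))
               refl k (F n) (F (suc n)) (F m) (F (suc m)) ⟩
    - (F n * F (suc m) - F (suc n) * F m)   ≈⟨ -‿cong (F-dOcagne n m) ⟩
    - (sgn m * Fℤ (n ⊖ℤ m))                 ≈⟨ -‿distribˡ-* (sgn m) _ ⟩
    sgn (suc m) * Fℤ (n ⊖ℤ m)               ≡⟨ ≡.cong (λ z → sgn (suc m) * Fℤ z) (ℤ.[1+m]⊖[1+n]≡m⊖n n m) ⟨
    sgn (suc m) * Fℤ (suc n ⊖ℤ suc m)       ∎

  ≈B-trans : ∀ {X Y Z} → X ≈B Y → Y ≈B Z → X ≈B Z
  ≈B-trans (p₁ , p₂ , p₃ , p₄) (q₁ , q₂ , q₃ , q₄) =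
    trans p₁ q₁ , trans p₂ q₂ , trans p₃ q₃ , trans p₄ q₄

  ◃-congʳ : ∀ {r s} X → r ≈ s → r ◃ X ≈B s ◃ X
  ◃-congʳ X r≈s = *-congʳ r≈s , *-congʳ r≈s , *-congʳ r≈s , *-congʳ r≈s

  quaternion : Carrier → Carrier → Bicomplex
  quaternion x y = bc x y (k * y + x) (k * (k * y + x) + y)

  -- With A = 1 + j + k ij and B = i + k j + (k² + 1) ij we have quaternion x y = x A + y B;
  -- expanding bilinearly, the difference is (x v − y u)(A² + k A B − B²), and
  -- A² + k A B − B² = D.
  quaternion-dOcagne : ∀ x y u v →
    quaternion x y · quaternion v (k * v + u) ⊖ quaternion y (k * y + x) · quaternion u v ≈B (x * v - y * u) ◃ D
  quaternion-dOcagne x y u v =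
      trans (solve 5 (λ k x y u v → Δre  k x y u v := (x :* v :- y :* u) :* con (0 , 0)) refl k x y u v)
            (*-congˡ ⟦0,0⟧ᵈ≈0#)
    , trans (solve 5 (λ k x y u v → Δci  k x y u v := (x :* v :- y :* u) :* con (0 , 0)) refl k x y u v)
            (*-congˡ ⟦0,0⟧ᵈ≈0#)
    , trans (solve 5 (λ k x y u v → Δcj  k x y u v := (x :* v :- y :* u) :* (:2 :* (k :* k :+ :2))) refl k x y u v)
            (*-congˡ (*-cong ⟦2⟧≈two (+-congˡ ⟦2⟧≈two)))
    , trans (solve 5 (λ k x y u v → Δcij k x y u v := (x :* v :- y :* u) :* (k :* k :* k :+ :2 :* k)) refl k x y u v)
            (*-congˡ (+-congˡ (*-congʳ ⟦2⟧≈two)))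
    where
    :2 : Polynomial 5
    :2 = con (1 , 0) :+ con (1 , 0)

    ⟦2⟧≈two : ⟦ 1 , 0 ⟧ᵈ + ⟦ 1 , 0 ⟧ᵈ ≈ two
    ⟦2⟧≈two = +-cong ⟦1,0⟧ᵈ≈1# ⟦1,0⟧ᵈ≈1#

    module _ (k x y u v : Polynomial 5) where
      f₂ f₃ f₄ g₂ g₃ g₄ : Polynomial 5
      f₂ = k :* y :+ x
      f₃ = k :* f₂ :+ y
      f₄ = k :* f₃ :+ f₂
      g₂ = k :* v :+ u
      g₃ = k :* g₂ :+ v
      g₄ = k :* g₃ :+ g₂

      Δre Δci Δcj Δcij : Polynomial 5
      Δre  = (x :* v :- y :* g₂ :- f₂ :* g₃ :+ f₃ :* g₄) :- (y :* u :- f₂ :* v :- f₃ :* g₂ :+ f₄ :* g₃)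
      Δci  = (x :* g₂ :+ y :* v :- f₂ :* g₄ :- f₃ :* g₃) :- (y :* v :+ f₂ :* u :- f₃ :* g₃ :- f₄ :* g₂)
      Δcj  = (x :* g₃ :+ f₂ :* v :- y :* g₄ :- f₃ :* g₂) :- (y :* g₂ :+ f₃ :* u :- f₂ :* g₃ :- f₄ :* v)
      Δcij = (x :* g₄ :+ f₃ :* v :+ y :* g₃ :+ f₂ :* g₂) :- (y :* g₃ :+ f₄ :* u :+ f₂ :* g₂ :+ f₃ :* v)

open import Data.Integer using (_-_)

mainTheorem5 : ∀ {c ℓ} (R : CommutativeRing c ℓ) (k : CommutativeRing.Carrier R) (n m : ℕ) →
    let open KFib R k in
    (Q n · Q (suc m)) ⊖ (Q (suc n) · Q m) ≈B (CommutativeRing._*_ R (sgn m) (Fℤ (+ n - + m))) ◃ D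
mainTheorem5 R k n m =
  ≈B-trans R k (quaternion-dOcagne R k (F n) (F (suc n)) (F m) (F (suc m)))
    (◃-congʳ R k D (trans (F-dOcagne R k n m) (*-congˡ (reflexive (≡.cong Fℤ (≡.sym (ℤ.m-n≡m⊖n n m)))))))
  where
  open CommutativeRing R using (trans; reflexive; *-congˡ)
  open KFib R k using (F; Fℤ; D)
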